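{- Let $M$ be a $C$-algebra with $T,F,U$. If $a,b\in M$ are such that $a\leq b$ and $b\in M_{\#}$, then $a\in M_{\#}$.
   Context: A $C$-algebra is an algebra $\langle M,\vee,\wedge,\neg\rangle$ of type $(2,2,1)$ satisfying, for all $\alpha,\beta,\gamma$: $\neg\neg\alpha=\alpha$; $\neg(\alpha\wedge\beta)=\neg\alpha\vee\neg\beta$; $(\alpha\wedge\beta)\wedge\gamma=\alpha\wedge(\beta\wedge\gamma)$; $\alpha\wedge(\beta\vee\gamma)=(\alpha\wedge\beta)\vee(\alpha\wedge\gamma)$; $(\alpha\vee\beta)\wedge\gamma=(\alpha\wedge\gamma)\vee(\neg\alpha\wedge\beta\wedge\gamma)$; $\alpha\vee(\alpha\wedge\beta)=\alpha$; $(\alpha\wedge\beta)\vee(\beta\wedge\alpha)=(\beta\wedge\alpha)\vee(\alpha\wedge\beta)$. A $C$-algebra with $T,F,U$ has nullary operations $T,F,U$: $T$ is the two-sided identity for $\wedge$, $F$ the two-sided identity for $\vee$, $U$ the fixed point of $\neg$. $M_{\#}=\{\alpha\in M:\alpha\vee\neg\alpha=T\}$. Order: $a\leq b$ iff $a\vee b=b$. -}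

module Defs where

open import Level using (Level; suc)
open import Relation.Binary.PropositionalEquality using (_≡_)

record CAlgebraTFU (ℓ : Level) : Set (suc ℓ) where
  infix 8 ¬_
  infixr 6 _∧_
  infixr 5 _∨_
  field
    Carrier : Set ℓ
    _∨_ : Carrier → Carrier → Carrier
    _∧_ : Carrier → Carrier → Carrier
    ¬_  : Carrier → Carrier
    T F U : Carrier
    ¬¬-inv    : ∀ α → ¬ (¬ α) ≡ α
    deMorgan  : ∀ α β → ¬ (α ∧ β) ≡ (¬ α) ∨ (¬ β)
    ∧-assoc   : ∀ α β γ → (α ∧ β) ∧ γ ≡ α ∧ (β ∧ γ)
    ∧-distribˡ-∨ : ∀ α β γ → α ∧ (β ∨ γ) ≡ (α ∧ β) ∨ (α ∧ γ)
    ∨-∧-distribʳ : ∀ α β γ → (α ∨ β) ∧ γ ≡ (α ∧ γ) ∨ ((¬ α) ∧ β ∧ γ)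
    absorb    : ∀ α β → α ∨ (α ∧ β) ≡ α
    ∧∨-comm   : ∀ α β → (α ∧ β) ∨ (β ∧ α) ≡ (β ∧ α) ∨ (α ∧ β)
    T-identityˡ : ∀ α → T ∧ α ≡ α
    T-identityʳ : ∀ α → α ∧ T ≡ α
    F-identityˡ : ∀ α → F ∨ α ≡ α
    F-identityʳ : ∀ α → α ∨ F ≡ α
    U-fixed   : ¬ U ≡ U

  _≤_ : Carrier → Carrier → Set ℓ
  a ≤ b = a ∨ b ≡ b

  _∈M♯ : Carrier → Set ℓ
  α ∈M♯ = α ∨ ¬ α ≡ T

-- A C-algebra need not be commutative, but ∨ is associative and
-- satisfies the "left regularity" law  α ∨ (¬ α ∧ β) = α ∨ β.  From these
-- one gets the key fact: if  a ∨ y = T  for SOME y, then already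
-- a ∨ ¬ a = T, because  a ∨ ¬ a = a ∨ (¬ a ∧ (a ∨ y))  and the summand
-- ¬ a ∧ a  is swallowed by a.  For the theorem, take  y = b ∨ ¬ b:  from
-- a ∨ b = b and associativity,  a ∨ (b ∨ ¬ b) = b ∨ ¬ b = T.

module Submission where

open import Defs
open import Level using (Level)
open import Relation.Binary.PropositionalEquality

module CAlgebraLemmas {ℓ : Level} (M : CAlgebraTFU ℓ) where
  open CAlgebraTFU M
  open ≡-Reasoning

  ¬-∧-¬ : ∀ α β → ¬ (¬ α ∧ ¬ β) ≡ α ∨ β
  ¬-∧-¬ α β = trans (deMorgan _ _) (cong₂ _∨_ (¬¬-inv α) (¬¬-inv β))

  ¬-∨ : ∀ α β → ¬ (α ∨ β) ≡ ¬ α ∧ ¬ β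
  ¬-∨ α β = trans (cong ¬_ (sym (¬-∧-¬ α β))) (¬¬-inv _)

  -- Associativity of ∨, transported from that of ∧ through ¬.
  ∨-assoc : ∀ α β γ → (α ∨ β) ∨ γ ≡ α ∨ (β ∨ γ)
  ∨-assoc α β γ = begin
    (α ∨ β) ∨ γ           ≡⟨ sym (¬-∧-¬ _ _) ⟩
    ¬ (¬ (α ∨ β) ∧ ¬ γ)   ≡⟨ cong (λ z → ¬ (z ∧ ¬ γ)) (¬-∨ α β) ⟩
    ¬ ((¬ α ∧ ¬ β) ∧ ¬ γ) ≡⟨ cong ¬_ (∧-assoc _ _ _) ⟩
    ¬ (¬ α ∧ (¬ β ∧ ¬ γ)) ≡⟨ cong (λ z → ¬ (¬ α ∧ z)) (sym (¬-∨ β γ)) ⟩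
    ¬ (¬ α ∧ ¬ (β ∨ γ))   ≡⟨ ¬-∧-¬ _ _ ⟩
    α ∨ (β ∨ γ)           ∎

  ∨-idem : ∀ α → α ∨ α ≡ α
  ∨-idem α = trans (cong (α ∨_) (sym (T-identityʳ α))) (absorb α T)

  ∨-¬-∧ : ∀ α β → α ∨ (¬ α ∧ β) ≡ α ∨ β
  ∨-¬-∧ α β = begin
    α ∨ (¬ α ∧ β)           ≡⟨ cong₂ (λ x y → x ∨ (¬ α ∧ y)) (sym (T-identityʳ α)) (sym (T-identityʳ β)) ⟩
    (α ∧ T) ∨ (¬ α ∧ β ∧ T) ≡⟨ sym (∨-∧-distribʳ α β T) ⟩
    (α ∨ β) ∧ T             ≡⟨ T-identityʳ _ ⟩
    α ∨ β                   ∎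

  ∨-¬∧-absorb : ∀ α → α ∨ (¬ α ∧ α) ≡ α
  ∨-¬∧-absorb α = trans (∨-¬-∧ α α) (∨-idem α)

  complemented-if-joins-to-T : ∀ a y → a ∨ y ≡ T → a ∈M♯
  complemented-if-joins-to-T a y a∨y≡T = begin
    a ∨ ¬ a                     ≡⟨ cong (a ∨_) (sym (T-identityʳ (¬ a))) ⟩
    a ∨ (¬ a ∧ T)               ≡⟨ cong (λ z → a ∨ (¬ a ∧ z)) (sym a∨y≡T) ⟩
    a ∨ (¬ a ∧ (a ∨ y))         ≡⟨ cong (a ∨_) (∧-distribˡ-∨ _ _ _) ⟩
    a ∨ ((¬ a ∧ a) ∨ (¬ a ∧ y)) ≡⟨ sym (∨-assoc _ _ _) ⟩
    (a ∨ (¬ a ∧ a)) ∨ (¬ a ∧ y) ≡⟨ cong (_∨ (¬ a ∧ y)) (∨-¬∧-absorb a) ⟩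
    a ∨ (¬ a ∧ y)               ≡⟨ ∨-¬-∧ a y ⟩
    a ∨ y                       ≡⟨ a∨y≡T ⟩
    T                           ∎

  ≤-absorbed-by-∨ : ∀ a b c → a ≤ b → a ∨ (b ∨ c) ≡ b ∨ c
  ≤-absorbed-by-∨ a b c a≤b = trans (sym (∨-assoc a b c)) (cong (_∨ c) a≤b)

proposition2p17 : {ℓ : Level} (M : CAlgebraTFU ℓ) → let open CAlgebraTFU M in
    (a b : Carrier) → a ≤ b → b ∈M♯ → a ∈M♯
proposition2p17 M a b a≤b b∈M♯ =
  complemented-if-joins-to-T a (b ∨ ¬ b)
    (trans (≤-absorbed-by-∨ a b (¬ b) a≤b) b∈M♯)
  where
  open CAlgebraTFU M
  open CAlgebraLemmas M
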